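{- Let $n\ge 2$, let $K_n$ be the complete graph on vertex set $[n]$, and let $r_{\rm BN}\colon\mathbb Z^n\to\mathbb Z$ be its Baker–Norine rank. Let $i\in\mathbb Z$ and let $\mathbf a\in\mathbb Z^n$ satisfy $a_1,\ldots,a_{n-2}\in\{0,\ldots,n-1\}$, $a_{n-1}=0$ and $\deg(\mathbf a)=i$. Then $$ a_1+\cdots+a_{n-2}\le i \iff a_n\ge 0 \iff r_{\rm BN}(\mathbf a)=r_{\rm BN}(\mathbf a-\mathbf e_{n-1})+1. $$
   Context: $\deg(\mathbf d)=d_1+\cdots+d_n$; $\mathbf e_j$ is the $j$-th standard basis vector. For a connected graph $G$ without self-loops on ordered vertices $v_1,\ldots,v_n$, $\Delta_G$ is its Laplacian (degree matrix minus adjacency matrix) viewed as a map $\mathbb Z^n\to\mathbb Z^n$; $\mathbf d\sim\mathbf d'$ iff $\mathbf d-\mathbf d'\in\mathrm{Image}(\Delta_G)$; $\mathcal N$ is the set of $\mathbf d$ not equivalent to any componentwise nonnegative vector; $f(\mathbf d)=\min_{\mathbf d'\in\mathcal N}\|\mathbf d-\mathbf d'\|_1$; $r_{\rm BN}=f-1$. -}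

module Defs where

open import Data.Nat using (ℕ; zero; suc)
import Data.Nat as ℕ
open import Data.Integer using (ℤ; +_; _+_; _-_; _≤_; ∣_∣; 0ℤ; 1ℤ)
open import Data.Fin using (Fin; zero; suc; _≟_)
open import Data.Product using (Σ; ∃; ∃-syntax; _×_; _,_)
open import Relation.Nullary using (¬_; yes; no)
open import Relation.Binary.PropositionalEquality using (_≡_)

-- Integer vectors in ℤ^n, as functions on the (0-indexed) vertex set Fin n.
ZVec : ℕ → Set
ZVec n = Fin n → ℤ

sumℤ : ∀ {n} → (Fin n → ℤ) → ℤ
sumℤ {zero}  x = 0ℤ
sumℤ {suc n} x = x zero + sumℤ (λ j → x (suc j))

sumℕ : ∀ {n} → (Fin n → ℕ) → ℕ
sumℕ {zero}  x = 0
sumℕ {suc n} x = x zero ℕ.+ sumℕ (λ j → x (suc j))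

deg : ∀ {n} → ZVec n → ℤ
deg = sumℤ

e : ∀ {n} → Fin n → ZVec n
e j k with j ≟ k
... | yes _ = 1ℤ
... | no  _ = 0ℤ

_-ᵥ_ : ∀ {n} → ZVec n → ZVec n → ZVec n
(x -ᵥ y) k = x k - y k

dist₁ : ∀ {n} → ZVec n → ZVec n → ℕ
dist₁ d d' = sumℕ (λ k → ∣ d k - d' k ∣)

-- A (multi)graph on vertices Fin n given by its adjacency matrix
-- (A i j = number of edges between v_i and v_j).
Adj : ℕ → Set
Adj n = Fin n → Fin n → ℕ

-- Laplacian Δ_G = degree matrix minus adjacency matrix:
-- (Δ x)_i = deg(v_i) x_i - Σ_j A i j x_j = Σ_j A i j (x_i - x_j)
-- (for graphs without self-loops, which is the case below).
laplacian : ∀ {n} → Adj n → ZVec n → ZVec n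
laplacian A x i = sumℤ (λ j → (+ A i j) Data.Integer.* (x i - x j))

_∼⟨_⟩_ : ∀ {n} → ZVec n → Adj n → ZVec n → Set
d ∼⟨ A ⟩ d' = ∃[ y ] (∀ k → (d -ᵥ d') k ≡ laplacian A y k)

Effective : ∀ {n} → ZVec n → Set
Effective d = ∀ k → 0ℤ ≤ d k

InN : ∀ {n} → Adj n → ZVec n → Set
InN A d = ¬ (∃[ d' ] (Effective d' × (d ∼⟨ A ⟩ d')))

-- IsF A d k :  f(d) = min_{d' ∈ 𝒩} ‖d - d'‖₁  equals k
-- (k is attained by some d' ∈ 𝒩 and is ≤ every such distance).
IsF : ∀ {n} → Adj n → ZVec n → ℕ → Set
IsF A d k =
  (∃[ d' ] (InN A d' × dist₁ d d' ≡ k)) ×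
  (∀ d'' → InN A d'' → k ℕ.≤ dist₁ d d'')

IsRankBN : ∀ {n} → Adj n → ZVec n → ℤ → Set
IsRankBN A d r = ∃[ k ] (IsF A d k × r ≡ + k - 1ℤ)

K : (n : ℕ) → Adj n
K n i j with i ≟ j
... | yes _ = 0
... | no  _ = 1

-- On K_n the function f has a closed form. Put φ(D,t) = Σᵢ ⌊(Dᵢ + t)/n⌋ − t. Since
-- (Δy)ᵢ = n yᵢ − Σ y, the vector D is equivalent to an effective one iff φ(D,t) ≥ 0 for some t,
-- and f(D) = Σ_{t<n} max(0, 1 + φ(D,t)). For the lower bound, any d ∈ 𝒩 gives D ⊓ d ∈ 𝒩, so
-- φ(D ⊓ d, t) < 0 for all t, and Hermite's identity Σ_{t<n} ⌊(z + t)/n⌋ = z turns the sum over t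
-- into deg D − deg (D ⊓ d) ≤ ‖D − d‖₁. Conversely, while some φ(D,t) ≥ 0 there is a v with
-- φ(D, −D_v) ≥ 0, and replacing D by D − e_v moves it by 1 and lowers the sum by at least 1.
-- For the vector a of the theorem, subtracting e_{n−1} changes only the term t = 0, and there
-- φ(a,0) = ⌊a_n/n⌋ because the other entries lie in [0, n). So the rank drops iff a_n ≥ 0, which
-- by deg a = a₁ + ⋯ + a_{n−2} + a_n is also the condition a₁ + ⋯ + a_{n−2} ≤ i.

module Submission where

open import Defs
open import Data.Nat as ℕ using (ℕ; zero; suc; z≤n; s≤s)
import Data.Nat.Properties as ℕP
open import Data.Integer as ℤ
  using (ℤ; +_; -[1+_]; _+_; _-_; _*_; -_; _≤_; _<_; 0ℤ; 1ℤ; -1ℤ; _/ℕ_; _%ℕ_; +≤+; +<+; ∣_∣; _⊓_)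
import Data.Integer.Properties as ℤP
open import Data.Integer.DivMod using (a≡a%ℕn+[a/ℕn]*n; n%ℕd<d; 0≤n⇒0≤n/ℕd)
open import Data.Integer.Tactic.RingSolver using (solve-∀)
open import Data.Fin as Fin using (Fin; zero; suc; inject₁; fromℕ; toℕ)
import Data.Fin.Properties as FinP
open import Data.Product using (∃-syntax; _×_; _,_; proj₁; proj₂)
open import Data.Sum using (inj₁; inj₂)
open import Relation.Nullary using (yes; no)
open import Relation.Binary.Definitions using (tri<; tri≈; tri>)
open import Relation.Binary.PropositionalEquality
open import Data.Empty using (⊥-elim)
open import Function.Base using (_∘_)
open import Function.Bundles using (_⇔_; mk⇔)
import Function.Properties.Equivalence as ⇔

-- Integers

i≤i+j⇔0≤j : ∀ i j → (i ≤ i + j) ⇔ (0ℤ ≤ j)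
i≤i+j⇔0≤j i j = mk⇔ (λ i≤i+j → subst (0ℤ ≤_) (cancel i j) (ℤP.i≤j⇒0≤j-i i≤i+j))
                    (λ 0≤j → ℤP.0≤i-j⇒j≤i (subst (0ℤ ≤_) (sym (cancel i j)) 0≤j))
  where
  cancel : ∀ i j → i + j - i ≡ j
  cancel = solve-∀

_⁺ : ℤ → ℕ
(+ n)    ⁺ = n
-[1+ n ] ⁺ = 0

⁺-mono-≤ : ∀ {z w} → z ≤ w → z ⁺ ℕ.≤ w ⁺
⁺-mono-≤ {+ _}      {+ _}      (+≤+ m≤n) = m≤n
⁺-mono-≤ { -[1+ _ ]}           _        = z≤n

[1+z]⁺≡1+z⁺ : ∀ {z} → 0ℤ ≤ z → (1ℤ + z) ⁺ ≡ suc (z ⁺)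
[1+z]⁺≡1+z⁺ {+ n} _ = refl

[1+z]⁺≡z⁺ : ∀ {z} → z < 0ℤ → (1ℤ + z) ⁺ ≡ z ⁺
[1+z]⁺≡z⁺ { -[1+ zero ]}  _ = refl
[1+z]⁺≡z⁺ { -[1+ suc n ]} _ = refl
[1+z]⁺≡z⁺ {+ n}           (+<+ ())

z⁺≤w : ∀ {z w} → z ≤ w → 0ℤ ≤ w → + (z ⁺) ≤ w
z⁺≤w {+ _}      z≤w _   = z≤w
z⁺≤w { -[1+ _ ]} _   0≤w = 0≤w

-- Finite sums

sumℤ-cong : ∀ {n} {f g : Fin n → ℤ} → (∀ i → f i ≡ g i) → sumℤ f ≡ sumℤ g
sumℤ-cong {zero}  f≗g = refl
sumℤ-cong {suc n} f≗g = cong₂ _+_ (f≗g zero) (sumℤ-cong (λ i → f≗g (suc i)))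

sumℤ-+ : ∀ {n} (f g : Fin n → ℤ) → sumℤ (λ i → f i + g i) ≡ sumℤ f + sumℤ g
sumℤ-+ {zero}  f g = refl
sumℤ-+ {suc n} f g =
  trans (cong (_+_ (f zero + g zero)) (sumℤ-+ (λ i → f (suc i)) (λ i → g (suc i))))
        (interchange (f zero) (g zero) _ _)
  where
  interchange : ∀ a b c d → (a + b) + (c + d) ≡ (a + c) + (b + d)
  interchange = solve-∀

sumℤ-- : ∀ {n} (f g : Fin n → ℤ) → sumℤ (λ i → f i - g i) ≡ sumℤ f - sumℤ g
sumℤ-- {zero}  f g = refl
sumℤ-- {suc n} f g =
  trans (cong (_+_ (f zero - g zero)) (sumℤ-- (λ i → f (suc i)) (λ i → g (suc i))))
        (interchange (f zero) (g zero) _ _)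
  where
  interchange : ∀ a b c d → (a - b) + (c - d) ≡ (a + c) - (b + d)
  interchange = solve-∀

sumℤ-const : ∀ n q → sumℤ {n} (λ _ → q) ≡ + n * q
sumℤ-const zero    q = sym (ℤP.*-zeroˡ q)
sumℤ-const (suc n) q = trans (cong (_+_ q) (sumℤ-const n q)) (sym (ℤP.suc-* (+ n) q))

sumℤ-zero : ∀ n → sumℤ {n} (λ _ → 0ℤ) ≡ 0ℤ
sumℤ-zero n = trans (sumℤ-const n 0ℤ) (ℤP.*-zeroʳ (+ n))

sumℤ-single : ∀ {n} (x : Fin n → ℤ) v → (∀ j → j ≢ v → x j ≡ 0ℤ) → sumℤ x ≡ x v
sumℤ-single {suc n} x zero    x≡0 =
  trans (cong (_+_ (x zero)) (trans (sumℤ-cong (λ j → x≡0 (suc j) λ ())) (sumℤ-zero n)))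
        (ℤP.+-identityʳ (x zero))
sumℤ-single {suc n} x (suc v) x≡0 =
  trans (cong (λ z → z + sumℤ (λ j → x (suc j))) (x≡0 zero λ ()))
        (trans (ℤP.+-identityˡ _)
               (sumℤ-single (λ j → x (suc j)) v (λ j j≢v → x≡0 (suc j) (j≢v ∘ FinP.suc-injective))))

sumℤ-mono-≤ : ∀ {n} {f g : Fin n → ℤ} → (∀ i → f i ≤ g i) → sumℤ f ≤ sumℤ g
sumℤ-mono-≤ {zero}  f≤g = ℤP.≤-refl
sumℤ-mono-≤ {suc n} f≤g = ℤP.+-mono-≤ (f≤g zero) (sumℤ-mono-≤ (λ i → f≤g (suc i)))

sumℤ-nonNeg : ∀ {n} {f : Fin n → ℤ} → (∀ i → 0ℤ ≤ f i) → 0ℤ ≤ sumℤ f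
sumℤ-nonNeg {n} {f} f≥0 =
  subst (_≤ sumℤ f) (sumℤ-zero n) (sumℤ-mono-≤ f≥0)

sumℤ-init-last : ∀ {n} (x : Fin (suc n) → ℤ) → sumℤ x ≡ sumℤ (λ j → x (inject₁ j)) + x (fromℕ n)
sumℤ-init-last {zero}  x = ℤP.+-comm (x zero) 0ℤ
sumℤ-init-last {suc n} x =
  trans (cong (_+_ (x zero)) (sumℤ-init-last (λ j → x (suc j)))) (sym (ℤP.+-assoc (x zero) _ _))

sumℤ-comm : ∀ {m n} (h : Fin m → Fin n → ℤ) →
            sumℤ (λ t → sumℤ (λ i → h i t)) ≡ sumℤ (λ i → sumℤ (λ t → h i t))
sumℤ-comm {m} {zero}  h = sym (sumℤ-zero m)
sumℤ-comm {n = suc n} h =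
  trans (cong (_+_ (sumℤ (λ i → h i zero))) (sumℤ-comm (λ i t → h i (suc t))))
        (sym (sumℤ-+ (λ i → h i zero) (λ i → sumℤ (λ t → h i (suc t)))))

sumℕ-toℤ : ∀ {n} (f : Fin n → ℕ) → + sumℕ f ≡ sumℤ (λ i → + f i)
sumℕ-toℤ {zero}  f = refl
sumℕ-toℤ {suc n} f = trans (ℤP.pos-+ (f zero) _) (cong (_+_ (+ f zero)) (sumℕ-toℤ (λ i → f (suc i))))

sumℕ-cong : ∀ {n} {f g : Fin n → ℕ} → (∀ i → f i ≡ g i) → sumℕ f ≡ sumℕ g
sumℕ-cong {zero}  f≗g = refl
sumℕ-cong {suc n} f≗g = cong₂ ℕ._+_ (f≗g zero) (sumℕ-cong (λ i → f≗g (suc i)))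

sumℕ-mono-≤ : ∀ {n} {f g : Fin n → ℕ} → (∀ i → f i ℕ.≤ g i) → sumℕ f ℕ.≤ sumℕ g
sumℕ-mono-≤ {zero}  f≤g = z≤n
sumℕ-mono-≤ {suc n} f≤g = ℕP.+-mono-≤ (f≤g zero) (sumℕ-mono-≤ (λ i → f≤g (suc i)))

sumℕ-mono-< : ∀ {n} {f g : Fin n → ℕ} → (∀ i → f i ℕ.≤ g i) → ∀ i → f i ℕ.< g i → sumℕ f ℕ.< sumℕ g
sumℕ-mono-< {suc n} f≤g zero    f<g = ℕP.+-mono-<-≤ f<g (sumℕ-mono-≤ (λ i → f≤g (suc i)))
sumℕ-mono-< {suc n} f≤g (suc i) f<g = ℕP.+-mono-≤-< (f≤g zero) (sumℕ-mono-< (λ i → f≤g (suc i)) i f<g)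

-- Floor division

module Floor (k : ℕ) where

  N : ℤ
  N = + suc k

  ⌊_⌋ : ℤ → ℤ
  ⌊ x ⌋ = x /ℕ suc k

  rem : ℤ → ℕ
  rem x = x %ℕ suc k

  rem<N : ∀ x → rem x ℕ.< suc k
  rem<N x = n%ℕd<d x (suc k)

  x≡rem+⌊x⌋*N : ∀ x → x ≡ + rem x + ⌊ x ⌋ * N
  x≡rem+⌊x⌋*N x = a≡a%ℕn+[a/ℕn]*n x (suc k)

  r+q*N<r'+q'*N : ∀ {r r' q q'} → r ℕ.< suc k → q < q' → + r + q * N < + r' + q' * N
  r+q*N<r'+q'*N {r} {r'} {q} {q'} r<N q<q' = begin-strict
    + r + q * N   <⟨ ℤP.+-monoˡ-< (q * N) (+<+ r<N) ⟩
    N + q * N     ≡⟨ sym (ℤP.suc-* q N) ⟩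
    ℤ.suc q * N   ≤⟨ ℤP.*-monoʳ-≤-nonNeg N (ℤP.i<j⇒suc[i]≤j q<q') ⟩
    q' * N        ≤⟨ ℤP.i≤j+i (q' * N) (+ r') ⟩
    + r' + q' * N ∎
    where open ℤP.≤-Reasoning

  ⌊⌋-unique : ∀ {x q r} → r ℕ.< suc k → x ≡ + r + q * N → ⌊ x ⌋ ≡ q
  ⌊⌋-unique {x} {q} {r} r<N x≡r+qN with ℤP.<-cmp ⌊ x ⌋ q
  ... | tri< ⌊x⌋<q _ _ = ⊥-elim (ℤP.<-irrefl (trans (sym (x≡rem+⌊x⌋*N x)) x≡r+qN)
                                  (r+q*N<r'+q'*N (rem<N x) ⌊x⌋<q))
  ... | tri≈ _ ⌊x⌋≡q _ = ⌊x⌋≡q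
  ... | tri> _ _ ⌊x⌋>q = ⊥-elim (ℤP.<-irrefl (trans (sym x≡r+qN) (x≡rem+⌊x⌋*N x))
                                  (r+q*N<r'+q'*N r<N ⌊x⌋>q))

  ⌊x+q*N⌋ : ∀ x q → ⌊ x + q * N ⌋ ≡ ⌊ x ⌋ + q
  ⌊x+q*N⌋ x q = ⌊⌋-unique (rem<N x) (trans (cong (_+ q * N) (x≡rem+⌊x⌋*N x)) (regroup (+ rem x) ⌊ x ⌋ q N))
    where
    regroup : ∀ r p q n → r + p * n + q * n ≡ r + (p + q) * n
    regroup = solve-∀

  ⌊x⌋≡0 : ∀ {x} → 0ℤ ≤ x → x < N → ⌊ x ⌋ ≡ 0ℤ
  ⌊x⌋≡0 {+ r} _ (+<+ r<N) = ⌊⌋-unique r<N (sym (ℤP.+-identityʳ (+ r)))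

  ⌊q*N⌋≡q : ∀ q → ⌊ q * N ⌋ ≡ q
  ⌊q*N⌋≡q q = ⌊⌋-unique (s≤s z≤n) (sym (ℤP.+-identityˡ (q * N)))

  ⌊q*N-1⌋≡q-1 : ∀ q → ⌊ q * N - 1ℤ ⌋ ≡ q - 1ℤ
  ⌊q*N-1⌋≡q-1 q = ⌊⌋-unique ℕP.≤-refl (shift q (+ k))
    where
    shift : ∀ q k → q * (1ℤ + k) - 1ℤ ≡ k + (q - 1ℤ) * (1ℤ + k)
    shift = solve-∀

  ⌊x-1⌋≡⌊x⌋ : ∀ x → rem x ≢ 0 → ⌊ x - 1ℤ ⌋ ≡ ⌊ x ⌋
  ⌊x-1⌋≡⌊x⌋ x rem≢0 with rem x | rem<N x | x≡rem+⌊x⌋*N x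
  ... | zero  | _       | _ = ⊥-elim (rem≢0 refl)
  ... | suc r | s≤s r<k | x≡r+1+qN = ⌊⌋-unique (ℕP.m≤n⇒m≤1+n r<k) (trans (cong (_- 1ℤ) x≡r+1+qN) (shift (+ r) ⌊ x ⌋ N))
    where
    shift : ∀ r q n → (1ℤ + r) + q * n - 1ℤ ≡ r + q * n
    shift = solve-∀

  ⌊⌋-mono-≤ : ∀ {x y} → x ≤ y → ⌊ x ⌋ ≤ ⌊ y ⌋
  ⌊⌋-mono-≤ {x} {y} x≤y = ℤP.≮⇒≥ λ ⌊y⌋<⌊x⌋ →
    ℤP.<⇒≱ (subst₂ _<_ (sym (x≡rem+⌊x⌋*N y)) (sym (x≡rem+⌊x⌋*N x)) (r+q*N<r'+q'*N (rem<N y) ⌊y⌋<⌊x⌋)) x≤y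

  ⌊⌋-nonNeg : ∀ {x} → 0ℤ ≤ x → 0ℤ ≤ ⌊ x ⌋
  ⌊⌋-nonNeg {x} = 0≤n⇒0≤n/ℕd x (suc k)

  ⌊⌋-neg : ∀ {x} → x < 0ℤ → ⌊ x ⌋ < 0ℤ
  ⌊⌋-neg {x} x<0 = ℤP.i≤pred[j]⇒i<j (subst (⌊ x ⌋ ≤_) (⌊q*N-1⌋≡q-1 0ℤ) (⌊⌋-mono-≤ (ℤP.i<j⇒i≤pred[j] x<0)))

  0≤⌊x⌋⇔0≤x : ∀ x → (0ℤ ≤ ⌊ x ⌋) ⇔ (0ℤ ≤ x)
  0≤⌊x⌋⇔0≤x x = mk⇔ (λ ⌊x⌋≥0 → ℤP.≮⇒≥ (λ x<0 → ℤP.<⇒≱ (⌊⌋-neg x<0) ⌊x⌋≥0)) ⌊⌋-nonNeg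

  ⌊z+t⌋-sum : ℤ → ℤ
  ⌊z+t⌋-sum z = sumℤ (λ (t : Fin (suc k)) → ⌊ z + + toℕ t ⌋)

  ⌊z+t⌋-sum-suc : ∀ z → ⌊z+t⌋-sum (1ℤ + z) ≡ 1ℤ + ⌊z+t⌋-sum z
  ⌊z+t⌋-sum-suc z = begin
    ⌊z+t⌋-sum (1ℤ + z)
      ≡⟨ sumℤ-init-last {k} (λ t → ⌊ 1ℤ + z + + toℕ t ⌋) ⟩
    sumℤ (λ (t : Fin k) → ⌊ 1ℤ + z + + toℕ (inject₁ t) ⌋) + ⌊ 1ℤ + z + + toℕ (fromℕ k) ⌋
      ≡⟨ cong₂ _+_ (sumℤ-cong {k} λ t → cong (λ r → ⌊ 1ℤ + z + + r ⌋) (FinP.toℕ-inject₁ t))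
                   (cong (λ r → ⌊ 1ℤ + z + + r ⌋) (FinP.toℕ-fromℕ k)) ⟩
    sumℤ (λ (t : Fin k) → ⌊ 1ℤ + z + + toℕ t ⌋) + ⌊ 1ℤ + z + + k ⌋
      ≡⟨ cong₂ _+_ (sumℤ-cong {k} λ t → cong ⌊_⌋ (shift-in z (+ toℕ t)))
                   (trans (cong ⌊_⌋ (shift-out z (+ k))) (⌊x+q*N⌋ z 1ℤ)) ⟩
    T + (⌊ z ⌋ + 1ℤ)
      ≡⟨ swap T ⌊ z ⌋ ⟩
    1ℤ + (⌊ z ⌋ + T)
      ≡⟨ cong (λ w → 1ℤ + (⌊ w ⌋ + T)) (sym (ℤP.+-identityʳ z)) ⟩
    1ℤ + ⌊z+t⌋-sum z ∎
    where
    open ≡-Reasoning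
    T = sumℤ (λ (t : Fin k) → ⌊ z + + toℕ (suc t) ⌋)
    shift-in : ∀ z t → 1ℤ + z + t ≡ z + (1ℤ + t)
    shift-in = solve-∀
    shift-out : ∀ z k → 1ℤ + z + k ≡ z + 1ℤ * (1ℤ + k)
    shift-out = solve-∀
    swap : ∀ a b → a + (b + 1ℤ) ≡ 1ℤ + (b + a)
    swap = solve-∀

  ⌊z+t⌋-sum-shift : ∀ z q → ⌊z+t⌋-sum (z + q * N) ≡ ⌊z+t⌋-sum z + q * N
  ⌊z+t⌋-sum-shift z q = begin
    ⌊z+t⌋-sum (z + q * N)
      ≡⟨ sumℤ-cong {suc k} (λ t → trans (cong ⌊_⌋ (exchange z (q * N) (+ toℕ t))) (⌊x+q*N⌋ (z + + toℕ t) q)) ⟩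
    sumℤ (λ (t : Fin (suc k)) → ⌊ z + + toℕ t ⌋ + q)
      ≡⟨ sumℤ-+ {suc k} (λ t → ⌊ z + + toℕ t ⌋) (λ _ → q) ⟩
    ⌊z+t⌋-sum z + sumℤ {suc k} (λ _ → q)
      ≡⟨ cong (_+_ (⌊z+t⌋-sum z)) (trans (sumℤ-const (suc k) q) (ℤP.*-comm N q)) ⟩
    ⌊z+t⌋-sum z + q * N ∎
    where
    open ≡-Reasoning
    exchange : ∀ a b c → a + b + c ≡ a + c + b
    exchange = solve-∀

  hermite : ∀ z → ⌊z+t⌋-sum z ≡ z
  hermite z = trans (cong ⌊z+t⌋-sum (x≡rem+⌊x⌋*N z))
             (trans (⌊z+t⌋-sum-shift (+ rem z) ⌊ z ⌋)
             (trans (cong (_+ ⌊ z ⌋ * N) (on-ℕ (rem z))) (sym (x≡rem+⌊x⌋*N z))))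
    where
    on-ℕ : ∀ r → ⌊z+t⌋-sum (+ r) ≡ + r
    on-ℕ zero    = trans (sumℤ-cong (λ t → ⌊x⌋≡0 (+≤+ z≤n) (+<+ (FinP.toℕ<n t)))) (sumℤ-zero (suc k))
    on-ℕ (suc r) = trans (⌊z+t⌋-sum-suc (+ r)) (cong (_+_ 1ℤ) (on-ℕ r))

-- Divisors, distances and ranks

e-self : ∀ {n} (i : Fin n) → e i i ≡ 1ℤ
e-self i with i Fin.≟ i
... | yes _   = refl
... | no  i≢i = ⊥-elim (i≢i refl)

e-other : ∀ {n} {i j : Fin n} → i ≢ j → e i j ≡ 0ℤ
e-other {i = i} {j} i≢j with i Fin.≟ j
... | yes i≡j = ⊥-elim (i≢j i≡j)
... | no  _   = refl

-ᵥe-≤ : ∀ {n} (D : ZVec n) v i → (D -ᵥ e v) i ≤ D i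
-ᵥe-≤ D v i with v Fin.≟ i
... | yes _ = ℤP.i-j≤i (D i) 1ℤ
... | no  _ = ℤP.i-j≤i (D i) 0ℤ

laplacian-K : ∀ {n} (y : ZVec n) i → laplacian (K n) y i ≡ + n * y i - sumℤ y
laplacian-K {n} y i = begin
  sumℤ (λ j → + K n i j * (y i - y j)) ≡⟨ sumℤ-cong K-term ⟩
  sumℤ (λ j → y i - y j)               ≡⟨ sumℤ-- (λ _ → y i) y ⟩
  sumℤ {n} (λ _ → y i) - sumℤ y        ≡⟨ cong (_- sumℤ y) (sumℤ-const n (y i)) ⟩
  + n * y i - sumℤ y                   ∎
  where
  open ≡-Reasoning
  K-term : ∀ j → + K n i j * (y i - y j) ≡ y i - y j
  K-term j with i Fin.≟ j
  ... | yes refl = trans (ℤP.*-zeroˡ (y i - y i)) (sym (ℤP.+-inverseʳ (y i)))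
  ... | no  _    = ℤP.*-identityˡ (y i - y j)

InN-≤ : ∀ {n} {A : Adj n} {x y : ZVec n} → (∀ i → x i ≤ y i) → InN A y → InN A x
InN-≤ {x = x} {y} x≤y y∈𝒩 (E , E≥0 , z , x-E≡Δz) =
  y∈𝒩 ( (λ i → E i + (y i - x i))
      , (λ i → ℤP.+-mono-≤ (E≥0 i) (ℤP.i≤j⇒0≤j-i (x≤y i)))
      , z , λ i → trans (cancel (y i) (x i) (E i)) (x-E≡Δz i))
  where
  cancel : ∀ a b c → a - (c + (a - b)) ≡ b - c
  cancel = solve-∀

dist₁-self : ∀ {n} (D : ZVec n) → dist₁ D D ≡ 0
dist₁-self {zero}  D = refl
dist₁-self {suc n} D = cong₂ ℕ._+_ (cong ∣_∣ (ℤP.+-inverseʳ (D zero))) (dist₁-self (λ i → D (suc i)))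

dist₁-sub-e : ∀ {n} (D d : ZVec n) v → dist₁ D d ℕ.≤ suc (dist₁ (D -ᵥ e v) d)
dist₁-sub-e D d v = ℤP.drop‿+≤+ (begin
  + dist₁ D d
    ≡⟨ sumℕ-toℤ (λ i → ∣ D i - d i ∣) ⟩
  sumℤ (λ i → + ∣ D i - d i ∣)
    ≤⟨ sumℤ-mono-≤ (λ i → +≤+ (subst (λ w → ∣ w ∣ ℕ.≤ ∣ D i - e v i - d i ∣ ℕ.+ ∣ e v i ∣) (cancel (D i) (d i) (e v i))
                                      (ℤP.∣i+j∣≤∣i∣+∣j∣ (D i - e v i - d i) (e v i)))) ⟩
  sumℤ (λ i → + ∣ D i - e v i - d i ∣ + + ∣ e v i ∣)
    ≡⟨ sumℤ-+ (λ i → + ∣ D i - e v i - d i ∣) (λ i → + ∣ e v i ∣) ⟩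
  sumℤ (λ i → + ∣ D i - e v i - d i ∣) + sumℤ (λ i → + ∣ e v i ∣)
    ≡⟨ cong₂ _+_ (sym (sumℕ-toℤ (λ i → ∣ D i - e v i - d i ∣))) Σ∣e∣≡1 ⟩
  + dist₁ (D -ᵥ e v) d + 1ℤ
    ≡⟨ ℤP.+-comm (+ dist₁ (D -ᵥ e v) d) 1ℤ ⟩
  + suc (dist₁ (D -ᵥ e v) d) ∎)
  where
  open ℤP.≤-Reasoning
  cancel : ∀ a b c → a - c - b + c ≡ a - b
  cancel = solve-∀
  Σ∣e∣≡1 : sumℤ (λ i → + ∣ e v i ∣) ≡ 1ℤ
  Σ∣e∣≡1 = trans (sumℤ-single _ v (λ j j≢v → cong (λ w → + ∣ w ∣) (e-other (j≢v ∘ sym))))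
                 (cong (λ w → + ∣ w ∣) (e-self v))

deg-deg[⊓]≤dist₁ : ∀ {n} (D d : ZVec n) → deg D - deg (λ i → D i ⊓ d i) ≤ + dist₁ D d
deg-deg[⊓]≤dist₁ D d = begin
  deg D - deg (λ i → D i ⊓ d i)  ≡⟨ sym (sumℤ-- D _) ⟩
  sumℤ (λ i → D i - D i ⊓ d i)  ≤⟨ sumℤ-mono-≤ term≤ ⟩
  sumℤ (λ i → + ∣ D i - d i ∣)  ≡⟨ sym (sumℕ-toℤ (λ i → ∣ D i - d i ∣)) ⟩
  + dist₁ D d                    ∎
  where
  open ℤP.≤-Reasoning
  term≤ : ∀ i → D i - D i ⊓ d i ≤ + ∣ D i - d i ∣
  term≤ i with ℤP.≤-total (D i) (d i)
  ... | inj₁ D≤d = subst (_≤ + ∣ D i - d i ∣)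
                        (sym (trans (cong (_-_ (D i)) (ℤP.i≤j⇒i⊓j≡i D≤d)) (ℤP.+-inverseʳ (D i)))) (+≤+ z≤n)
  ... | inj₂ d≤D = ℤP.≤-reflexive (trans (cong (_-_ (D i)) (ℤP.i≥j⇒i⊓j≡j d≤D))
                                         (sym (ℤP.0≤i⇒+∣i∣≡i (ℤP.i≤j⇒0≤j-i d≤D))))

IsF-unique : ∀ {n} {A : Adj n} {D a b} → IsF A D a → IsF A D b → a ≡ b
IsF-unique ((d , d∈𝒩 , a≡) , a≤) ((d' , d'∈𝒩 , b≡) , b≤) =
  ℕP.≤-antisym (subst (_ ℕ.≤_) b≡ (a≤ d' d'∈𝒩)) (subst (_ ℕ.≤_) a≡ (b≤ d d∈𝒩))

IsRankBN-unique : ∀ {n} {A : Adj n} {D r r'} → IsRankBN A D r → IsRankBN A D r' → r ≡ r'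
IsRankBN-unique {A = A} {D} (a , Fa , r≡) (b , Fb , r'≡) =
  trans r≡ (trans (cong (λ c → + c - 1ℤ) (IsF-unique {A = A} {D} Fa Fb)) (sym r'≡))

-- The complete graph

module CompleteGraph (k : ℕ) where
  open Floor k

  ψ : ZVec (suc k) → ℤ → ℤ
  ψ D t = sumℤ (λ i → ⌊ D i + t ⌋)

  φ : ZVec (suc k) → ℤ → ℤ
  φ D t = ψ D t - t

  φ-periodic : ∀ D s q → φ D (s + q * N) ≡ φ D s
  φ-periodic D s q = begin
    ψ D (s + q * N) - (s + q * N)
      ≡⟨ cong (_- (s + q * N)) (sumℤ-cong (λ i → trans (cong ⌊_⌋ (sym (ℤP.+-assoc (D i) s (q * N))))
                                                        (⌊x+q*N⌋ (D i + s) q))) ⟩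
    sumℤ (λ i → ⌊ D i + s ⌋ + q) - (s + q * N)
      ≡⟨ cong (_- (s + q * N)) (trans (sumℤ-+ (λ i → ⌊ D i + s ⌋) (λ _ → q)) (cong (_+_ (ψ D s)) (sumℤ-const (suc k) q))) ⟩
    ψ D s + N * q - (s + q * N)
      ≡⟨ cancel (ψ D s) s q N ⟩
    ψ D s - s ∎
    where
    open ≡-Reasoning
    cancel : ∀ a s q n → a + n * q - (s + q * n) ≡ a - s
    cancel = solve-∀

  φ-at-root : ∀ D i s q → D i + s ≡ q * N → φ D (- D i) ≡ φ D s
  φ-at-root D i s q Di+s≡qN = begin
    φ D (- D i)           ≡⟨ cong (φ D) (trans (isolate (D i) s) (cong (_-_ s) Di+s≡qN)) ⟩
    φ D (s - q * N)       ≡⟨ cong (λ w → φ D (s + w)) (ℤP.neg-distribˡ-* q N) ⟩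
    φ D (s + (- q) * N)   ≡⟨ φ-periodic D s (- q) ⟩
    φ D s                 ∎
    where
    open ≡-Reasoning
    isolate : ∀ d s → - d ≡ s - (d + s)
    isolate = solve-∀

  φ≥0⇒∼effective : ∀ D t → 0ℤ ≤ φ D t → ∃[ E ] (Effective E × D ∼⟨ K (suc k) ⟩ E)
  φ≥0⇒∼effective D t φ≥0 =
    E , (λ i → subst (0ℤ ≤_) (sym (E≡rem+φ i)) (ℤP.+-mono-≤ (+≤+ z≤n) φ≥0)) ,
    y , λ i → cancel (D i) (laplacian (K (suc k)) y i)
    where
    y : ZVec (suc k)
    y i = ⌊ D i + t ⌋
    E : ZVec (suc k)
    E i = D i - laplacian (K (suc k)) y i
    E≡rem+φ : ∀ i → E i ≡ + rem (D i + t) + φ D t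
    E≡rem+φ i = begin
      D i - laplacian (K (suc k)) y i            ≡⟨ cong (_-_ (D i)) (laplacian-K y i) ⟩
      D i - (N * y i - ψ D t)                    ≡⟨ regroup (D i) t (y i) (ψ D t) N ⟩
      D i + t - y i * N + φ D t                  ≡⟨ cong (λ w → w - y i * N + φ D t) (x≡rem+⌊x⌋*N (D i + t)) ⟩
      + rem (D i + t) + y i * N - y i * N + φ D t ≡⟨ drop (+ rem (D i + t)) (y i * N) (φ D t) ⟩
      + rem (D i + t) + φ D t                    ∎
      where
      open ≡-Reasoning
      regroup : ∀ d t y p n → d - (n * y - p) ≡ d + t - y * n + (p - t)
      regroup = solve-∀
      drop : ∀ r m p → r + m - m + p ≡ r + p
      drop = solve-∀
    cancel : ∀ a b → a - (a - b) ≡ b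
    cancel = solve-∀

  ∼effective⇒φ≥0 : ∀ {D E} → Effective E → D ∼⟨ K (suc k) ⟩ E → ∃[ t ] (0ℤ ≤ φ D (+ toℕ {suc k} t))
  ∼effective⇒φ≥0 {D} {E} E≥0 (y , D-E≡Δy) =
    Fin.fromℕ< (rem<N S) , subst (0ℤ ≤_) φ≡ΣE (sumℤ-nonNeg (λ i → ⌊⌋-nonNeg (E≥0 i)))
    where
    S = sumℤ y
    D+S≡E+yN : ∀ i → D i + S ≡ E i + y i * N
    D+S≡E+yN i = begin
      D i + S                 ≡⟨ regroup (D i) (E i) S ⟩
      (D i - E i) + S + E i   ≡⟨ cong (λ w → w + S + E i) (trans (D-E≡Δy i) (laplacian-K y i)) ⟩
      (N * y i - S) + S + E i ≡⟨ cancel (N * y i) S (E i) ⟩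
      E i + N * y i           ≡⟨ cong (_+_ (E i)) (ℤP.*-comm N (y i)) ⟩
      E i + y i * N           ∎
      where
      open ≡-Reasoning
      regroup : ∀ d e s → d + s ≡ (d - e) + s + e
      regroup = solve-∀
      cancel : ∀ m s e → (m - s) + s + e ≡ e + m
      cancel = solve-∀
    φ≡ΣE : sumℤ (λ i → ⌊ E i ⌋) ≡ φ D (+ toℕ (Fin.fromℕ< (rem<N S)))
    φ≡ΣE = sym (begin
      φ D (+ toℕ (Fin.fromℕ< (rem<N S)))  ≡⟨ cong (λ r → φ D (+ r)) (FinP.toℕ-fromℕ< (rem<N S)) ⟩
      φ D (+ rem S)                        ≡⟨ sym (φ-periodic D (+ rem S) ⌊ S ⌋) ⟩
      φ D (+ rem S + ⌊ S ⌋ * N)            ≡⟨ cong (φ D) (sym (x≡rem+⌊x⌋*N S)) ⟩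
      ψ D S - S                            ≡⟨ cong (_- S) (sumℤ-cong (λ i → trans (cong ⌊_⌋ (D+S≡E+yN i)) (⌊x+q*N⌋ (E i) (y i)))) ⟩
      sumℤ (λ i → ⌊ E i ⌋ + y i) - S       ≡⟨ cong (_- S) (sumℤ-+ (λ i → ⌊ E i ⌋) y) ⟩
      sumℤ (λ i → ⌊ E i ⌋) + S - S         ≡⟨ cancel (sumℤ (λ i → ⌊ E i ⌋)) S ⟩
      sumℤ (λ i → ⌊ E i ⌋)                 ∎)
      where
      open ≡-Reasoning
      cancel : ∀ a s → a + s - s ≡ a
      cancel = solve-∀

  InN⇒φ<0 : ∀ {D} → InN (K (suc k)) D → ∀ t → φ D t < 0ℤ
  InN⇒φ<0 {D} D∈𝒩 t with 0ℤ ℤP.≤? φ D t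
  ... | yes φ≥0 = ⊥-elim (D∈𝒩 (φ≥0⇒∼effective D t φ≥0))
  ... | no  φ≱0 = ℤP.≰⇒> φ≱0

  φ<0⇒InN : ∀ {D} → (∀ (t : Fin (suc k)) → φ D (+ toℕ t) < 0ℤ) → InN (K (suc k)) D
  φ<0⇒InN {D} φ<0 (E , E≥0 , D∼E) with ∼effective⇒φ≥0 {D} E≥0 D∼E
  ... | t , φ≥0 = ℤP.<⇒≱ (φ<0 t) φ≥0

  ψ-mono-≤ : ∀ {x D} → (∀ i → x i ≤ D i) → ∀ t → ψ x t ≤ ψ D t
  ψ-mono-≤ x≤D t = sumℤ-mono-≤ (λ i → ⌊⌋-mono-≤ (ℤP.+-monoˡ-≤ t (x≤D i)))

  sumℤ-ψ≡deg : ∀ D → sumℤ (λ (t : Fin (suc k)) → ψ D (+ toℕ t)) ≡ deg D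
  sumℤ-ψ≡deg D = trans (sumℤ-comm (λ i (t : Fin (suc k)) → ⌊ D i + + toℕ t ⌋)) (sumℤ-cong (λ i → hermite (D i)))

  φ-sub-e : ∀ D v t → φ D t - φ (D -ᵥ e v) t ≡ ⌊ D v + t ⌋ - ⌊ D v + t - 1ℤ ⌋
  φ-sub-e D v t = begin
    φ D t - φ (D -ᵥ e v) t                    ≡⟨ cancel (ψ D t) (ψ (D -ᵥ e v) t) t ⟩
    ψ D t - ψ (D -ᵥ e v) t                    ≡⟨ sym (sumℤ-- (λ i → ⌊ D i + t ⌋) (λ i → ⌊ (D -ᵥ e v) i + t ⌋)) ⟩
    sumℤ (λ i → ⌊ D i + t ⌋ - ⌊ (D -ᵥ e v) i + t ⌋) ≡⟨ sumℤ-single _ v off-v ⟩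
    ⌊ D v + t ⌋ - ⌊ D v - e v v + t ⌋          ≡⟨ cong (λ w → ⌊ D v + t ⌋ - ⌊ w ⌋) (trans (cong (λ c → D v - c + t) (e-self v)) (swap (D v) t)) ⟩
    ⌊ D v + t ⌋ - ⌊ D v + t - 1ℤ ⌋ ∎
    where
    open ≡-Reasoning
    cancel : ∀ a b t → (a - t) - (b - t) ≡ a - b
    cancel = solve-∀
    swap : ∀ d t → d - 1ℤ + t ≡ d + t - 1ℤ
    swap = solve-∀
    off-v : ∀ j → j ≢ v → ⌊ D j + t ⌋ - ⌊ (D -ᵥ e v) j + t ⌋ ≡ 0ℤ
    off-v j j≢v = trans (cong (λ c → ⌊ D j + t ⌋ - ⌊ D j - c + t ⌋) (e-other (j≢v ∘ sym)))
                        (trans (cong (λ w → ⌊ D j + t ⌋ - ⌊ w + t ⌋) (ℤP.+-identityʳ (D j))) (ℤP.+-inverseʳ ⌊ D j + t ⌋))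

  φ-sub-e-at-root : ∀ D v s q → D v + s ≡ q * N → φ D s ≡ 1ℤ + φ (D -ᵥ e v) s
  φ-sub-e-at-root D v s q Dv+s≡qN = shift (φ D s) (φ (D -ᵥ e v) s) (begin
    φ D s - φ (D -ᵥ e v) s                  ≡⟨ φ-sub-e D v s ⟩
    ⌊ D v + s ⌋ - ⌊ D v + s - 1ℤ ⌋          ≡⟨ cong (λ w → ⌊ w ⌋ - ⌊ w - 1ℤ ⌋) Dv+s≡qN ⟩
    ⌊ q * N ⌋ - ⌊ q * N - 1ℤ ⌋              ≡⟨ cong₂ _-_ (⌊q*N⌋≡q q) (⌊q*N-1⌋≡q-1 q) ⟩
    q - (q - 1ℤ)                            ≡⟨ cancel q ⟩
    1ℤ                                      ∎)
    where
    open ≡-Reasoning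
    cancel : ∀ q → q - (q - 1ℤ) ≡ 1ℤ
    cancel = solve-∀
    shift : ∀ a b → a - b ≡ 1ℤ → a ≡ 1ℤ + b
    shift a b a-b≡1 = trans (split a b) (cong (_+ b) a-b≡1)
      where
      split : ∀ a b → a ≡ a - b + b
      split = solve-∀

  φ-sub-e-off-root : ∀ D v s → ⌊ D v + s - 1ℤ ⌋ ≡ ⌊ D v + s ⌋ → φ (D -ᵥ e v) s ≡ φ D s
  φ-sub-e-off-root D v s no-drop = sym (ℤP.i-j≡0⇒i≡j (φ D s) (φ (D -ᵥ e v) s)
    (trans (φ-sub-e D v s) (trans (cong (_-_ ⌊ D v + s ⌋) no-drop) (ℤP.+-inverseʳ ⌊ D v + s ⌋))))

  φ≤φ[s-1] : ∀ D s → (∀ i → rem (D i + s) ≢ 0) → φ D s ≤ φ D (s - 1ℤ)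
  φ≤φ[s-1] D s no-root = begin
    ψ D s - s                ≤⟨ ℤP.i≤i+j (ψ D s - s) 1ℤ ⟩
    ψ D s - s + 1ℤ           ≡⟨ regroup (ψ D s) s ⟩
    ψ D s - (s - 1ℤ)         ≡⟨ cong (_- (s - 1ℤ)) (sumℤ-cong λ i → sym (trans (cong ⌊_⌋ (sym (ℤP.+-assoc (D i) s -1ℤ)))
                                                                        (⌊x-1⌋≡⌊x⌋ (D i + s) (no-root i)))) ⟩
    ψ D (s - 1ℤ) - (s - 1ℤ)  ∎
    where
    open ℤP.≤-Reasoning
    regroup : ∀ p s → p - s + 1ℤ ≡ p - (s - 1ℤ)
    regroup = solve-∀

  -- Walking s downwards, φ D s does not decrease until some D v + s becomes divisible by N;
  -- the residue j of D zero + s bounds the number of steps.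
  φ≥0-at-root : ∀ D j s q → D zero + s ≡ + j + q * N → 0ℤ ≤ φ D s → ∃[ v ] (0ℤ ≤ φ D (- D v))
  φ≥0-at-root D zero s q D0+s≡qN φ≥0 =
    zero , subst (0ℤ ≤_) (sym (φ-at-root D zero s q (trans D0+s≡qN (ℤP.+-identityˡ (q * N))))) φ≥0
  φ≥0-at-root D (suc j) s q D0+s≡j+1+qN φ≥0 with FinP.any? (λ i → rem (D i + s) ℕ.≟ 0)
  ... | yes (v , rem≡0) = v , subst (0ℤ ≤_) (sym (φ-at-root D v s ⌊ D v + s ⌋ Dv+s≡qN)) φ≥0
    where
    Dv+s≡qN : D v + s ≡ ⌊ D v + s ⌋ * N
    Dv+s≡qN = trans (x≡rem+⌊x⌋*N (D v + s)) (trans (cong (λ r → + r + ⌊ D v + s ⌋ * N) rem≡0) (ℤP.+-identityˡ _))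
  ... | no  no-root     = φ≥0-at-root D j (s - 1ℤ) q (trans (sym (ℤP.+-assoc (D zero) s -1ℤ))
                            (trans (cong (_- 1ℤ) D0+s≡j+1+qN) (cancel (+ j) (q * N))))
                            (ℤP.≤-trans φ≥0 (φ≤φ[s-1] D s (λ i rem≡0 → no-root (i , rem≡0))))
    where
    cancel : ∀ j m → 1ℤ + j + m - 1ℤ ≡ j + m
    cancel = solve-∀

  f : ZVec (suc k) → ℕ
  f D = sumℕ (λ (t : Fin (suc k)) → (1ℤ + φ D (+ toℕ t)) ⁺)

  f≤dist₁ : ∀ D d → InN (K (suc k)) d → f D ℕ.≤ dist₁ D d
  f≤dist₁ D d d∈𝒩 = ℤP.drop‿+≤+ (begin
    + f D
      ≡⟨ sumℕ-toℤ {suc k} (λ t → (1ℤ + φ D (+ toℕ t)) ⁺) ⟩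
    sumℤ (λ (t : Fin (suc k)) → + (1ℤ + φ D (+ toℕ t)) ⁺)
      ≤⟨ sumℤ-mono-≤ {suc k} (λ t → term≤ (+ toℕ t)) ⟩
    sumℤ (λ (t : Fin (suc k)) → ψ D (+ toℕ t) - ψ x (+ toℕ t))
      ≡⟨ sumℤ-- {suc k} (λ t → ψ D (+ toℕ t)) (λ t → ψ x (+ toℕ t)) ⟩
    sumℤ (λ (t : Fin (suc k)) → ψ D (+ toℕ t)) - sumℤ (λ (t : Fin (suc k)) → ψ x (+ toℕ t))
      ≡⟨ cong₂ _-_ (sumℤ-ψ≡deg D) (sumℤ-ψ≡deg x) ⟩
    deg D - deg x
      ≤⟨ deg-deg[⊓]≤dist₁ D d ⟩
    + dist₁ D d ∎)
    where
    open ℤP.≤-Reasoning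
    x : ZVec (suc k)
    x i = D i ⊓ d i
    x∈𝒩 : InN (K (suc k)) x
    x∈𝒩 = InN-≤ {A = K (suc k)} (λ i → ℤP.i⊓j≤j (D i) (d i)) d∈𝒩
    -- 1 + φ D t = (ψ D t - ψ x t) + (1 + φ x t), and the second summand is ≤ 0 because x ∈ 𝒩.
    term≤ : ∀ t → + (1ℤ + φ D t) ⁺ ≤ ψ D t - ψ x t
    term≤ t = z⁺≤w (begin
        1ℤ + (ψ D t - t)                 ≡⟨ regroup (ψ D t) (ψ x t) t ⟩
        ψ D t - ψ x t + (1ℤ + φ x t)     ≤⟨ ℤP.+-monoʳ-≤ (ψ D t - ψ x t) (ℤP.i<j⇒suc[i]≤j (InN⇒φ<0 {x} x∈𝒩 t)) ⟩
        ψ D t - ψ x t + 0ℤ               ≡⟨ ℤP.+-identityʳ _ ⟩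
        ψ D t - ψ x t                    ∎)
      (ℤP.i≤j⇒0≤j-i (ψ-mono-≤ (λ i → ℤP.i⊓j≤i (D i) (d i)) t))
      where
      regroup : ∀ a b t → 1ℤ + (a - t) ≡ a - b + (1ℤ + (b - t))
      regroup = solve-∀

  φ-sub-e-≤ : ∀ D v t → φ (D -ᵥ e v) t ≤ φ D t
  φ-sub-e-≤ D v t = ℤP.+-monoˡ-≤ (- t) (ψ-mono-≤ (-ᵥe-≤ D v) t)

  -- The term at t ≡ − D v (mod N) drops by one and no term increases.
  f-sub-e< : ∀ D v → 0ℤ ≤ φ D (- D v) → f (D -ᵥ e v) ℕ.< f D
  f-sub-e< D v φ≥0 = sumℕ-mono-< (λ t → ⁺-mono-≤ (ℤP.+-monoʳ-≤ 1ℤ (φ-sub-e-≤ D v (+ toℕ t)))) t₀ strict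
    where
    q = ⌊ - D v ⌋
    t₀ = Fin.fromℕ< (rem<N (- D v))
    s = + toℕ t₀
    Dv+s≡-qN : D v + s ≡ (- q) * N
    Dv+s≡-qN = begin
      D v + s                                  ≡⟨ cong (λ r → D v + + r) (FinP.toℕ-fromℕ< (rem<N (- D v))) ⟩
      D v + + rem (- D v)                      ≡⟨ isolate (D v) (+ rem (- D v)) ⟩
      + rem (- D v) - (- D v)                  ≡⟨ cong (_-_ (+ rem (- D v))) (x≡rem+⌊x⌋*N (- D v)) ⟩
      + rem (- D v) - (+ rem (- D v) + q * N)  ≡⟨ cancel (+ rem (- D v)) q N ⟩
      (- q) * N                                ∎
      where
      open ≡-Reasoning
      isolate : ∀ d r → d + r ≡ r - (- d)
      isolate = solve-∀
      cancel : ∀ r q n → r - (r + q * n) ≡ (- q) * n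
      cancel = solve-∀
    strict : (1ℤ + φ (D -ᵥ e v) s) ⁺ ℕ.< (1ℤ + φ D s) ⁺
    strict = begin-strict
      (1ℤ + φ (D -ᵥ e v) s) ⁺  ≡⟨ cong _⁺ (sym (φ-sub-e-at-root D v s (- q) Dv+s≡-qN)) ⟩
      φ D s ⁺                  <⟨ ℕP.n<1+n (φ D s ⁺) ⟩
      suc (φ D s ⁺)            ≡⟨ sym ([1+z]⁺≡1+z⁺ (subst (0ℤ ≤_) (φ-at-root D v s (- q) Dv+s≡-qN) φ≥0)) ⟩
      (1ℤ + φ D s) ⁺           ∎
      where open ℕP.≤-Reasoning

  f-attained : ∀ fuel D → f D ℕ.< fuel → ∃[ d ] (InN (K (suc k)) d × dist₁ D d ℕ.≤ f D)
  f-attained (suc fuel) D f<1+fuel with FinP.any? (λ (t : Fin (suc k)) → 0ℤ ℤP.≤? φ D (+ toℕ t))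
  ... | no ∄φ≥0 =
    D , φ<0⇒InN {D} (λ t → ℤP.≰⇒> (λ φ≥0 → ∄φ≥0 (t , φ≥0))) , subst (ℕ._≤ f D) (sym (dist₁-self D)) z≤n
  ... | yes (t , φ≥0)
    with φ≥0-at-root D (rem (D zero + + toℕ t)) (+ toℕ t) ⌊ D zero + + toℕ t ⌋ (x≡rem+⌊x⌋*N (D zero + + toℕ t)) φ≥0
  ... | v , φ[-Dv]≥0
    with f-attained fuel (D -ᵥ e v) (ℕP.<-≤-trans (f-sub-e< D v φ[-Dv]≥0) (ℕP.≤-pred f<1+fuel))
  ... | d , d∈𝒩 , dist≤f =
    d , d∈𝒩 , ℕP.≤-trans (dist₁-sub-e D d v) (ℕP.≤-trans (s≤s dist≤f) (f-sub-e< D v φ[-Dv]≥0))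

  IsF-f : ∀ D → IsF (K (suc k)) D (f D)
  IsF-f D with f-attained (suc (f D)) D ℕP.≤-refl
  ... | d , d∈𝒩 , dist≤f = (d , d∈𝒩 , ℕP.≤-antisym dist≤f (f≤dist₁ D d d∈𝒩)) , f≤dist₁ D

  IsRankBN-f : ∀ D → IsRankBN (K (suc k)) D (+ f D - 1ℤ)
  IsRankBN-f D = f D , IsF-f D , refl

  f-tail : ZVec (suc k) → ℕ
  f-tail D = sumℕ (λ (t : Fin k) → (1ℤ + φ D (+ suc (toℕ t))) ⁺)

  f[D-e]≡ : ∀ D v → D v ≡ 0ℤ → f (D -ᵥ e v) ≡ φ D 0ℤ ⁺ ℕ.+ f-tail D
  f[D-e]≡ D v Dv≡0 = cong₂ ℕ._+_
    (cong _⁺ (sym (φ-sub-e-at-root D v 0ℤ 0ℤ (trans (ℤP.+-identityʳ (D v)) Dv≡0))))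
    (sumℕ-cong (λ t → cong (λ w → (1ℤ + w) ⁺) (φ-sub-e-off-root D v (+ suc (toℕ t)) (no-drop t))))
    where
    no-drop : ∀ (t : Fin k) → ⌊ D v + + suc (toℕ t) - 1ℤ ⌋ ≡ ⌊ D v + + suc (toℕ t) ⌋
    no-drop t rewrite Dv≡0 = trans (⌊x⌋≡0 (+≤+ z≤n) (+<+ (ℕP.m<n⇒m<1+n (FinP.toℕ<n t))))
                                    (sym (⌊x⌋≡0 (+≤+ z≤n) (+<+ (s≤s (FinP.toℕ<n t)))))

  f≡1+f[D-e] : ∀ D v → D v ≡ 0ℤ → 0ℤ ≤ φ D 0ℤ → f D ≡ suc (f (D -ᵥ e v))
  f≡1+f[D-e] D v Dv≡0 φ≥0 = trans (cong (ℕ._+ f-tail D) ([1+z]⁺≡1+z⁺ φ≥0)) (cong suc (sym (f[D-e]≡ D v Dv≡0)))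

  f≡f[D-e] : ∀ D v → D v ≡ 0ℤ → φ D 0ℤ < 0ℤ → f D ≡ f (D -ᵥ e v)
  f≡f[D-e] D v Dv≡0 φ<0 = trans (cong (ℕ._+ f-tail D) ([1+z]⁺≡z⁺ φ<0)) (sym (f[D-e]≡ D v Dv≡0))

  φ-at-0 : ∀ D → sumℤ (λ j → ⌊ D (inject₁ j) ⌋) ≡ 0ℤ → φ D 0ℤ ≡ ⌊ D (fromℕ k) ⌋
  φ-at-0 D Σ≡0 = begin
    ψ D 0ℤ - 0ℤ                                              ≡⟨ ℤP.+-identityʳ (ψ D 0ℤ) ⟩
    sumℤ (λ i → ⌊ D i + 0ℤ ⌋)                                ≡⟨ sumℤ-cong (λ i → cong ⌊_⌋ (ℤP.+-identityʳ (D i))) ⟩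
    sumℤ (λ i → ⌊ D i ⌋)                                     ≡⟨ sumℤ-init-last (λ i → ⌊ D i ⌋) ⟩
    sumℤ (λ j → ⌊ D (inject₁ j) ⌋) + ⌊ D (fromℕ k) ⌋         ≡⟨ cong (_+ ⌊ D (fromℕ k) ⌋) Σ≡0 ⟩
    0ℤ + ⌊ D (fromℕ k) ⌋                                     ≡⟨ ℤP.+-identityˡ ⌊ D (fromℕ k) ⌋ ⟩
    ⌊ D (fromℕ k) ⌋                                          ∎
    where open ≡-Reasoning

  RankDrops : ZVec (suc k) → Fin (suc k) → Set
  RankDrops D v = ∃[ r ] ∃[ r' ] (IsRankBN (K (suc k)) D r × IsRankBN (K (suc k)) (D -ᵥ e v) r' × r ≡ r' + 1ℤ)

  φ≥0⇔rank-drops : ∀ D v → D v ≡ 0ℤ → (0ℤ ≤ φ D 0ℤ) ⇔ RankDrops D v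
  φ≥0⇔rank-drops D v Dv≡0 = mk⇔
    (λ φ≥0 → _ , _ , IsRankBN-f D , IsRankBN-f (D -ᵥ e v) , rank-suc (f≡1+f[D-e] D v Dv≡0 φ≥0))
    φ≥0-from-rank
    where
    rank-suc : ∀ {x y} → x ≡ suc y → + x - 1ℤ ≡ (+ y - 1ℤ) + 1ℤ
    rank-suc {y = y} refl = shift (+ y)
      where
      shift : ∀ y → 1ℤ + y - 1ℤ ≡ y - 1ℤ + 1ℤ
      shift = solve-∀
    φ≥0-from-rank : RankDrops D v → 0ℤ ≤ φ D 0ℤ
    φ≥0-from-rank (r , r' , rD , rD' , r≡r'+1) with 0ℤ ℤP.≤? φ D 0ℤ
    ... | yes φ≥0 = φ≥0
    ... | no  φ≱0 = ⊥-elim (ℤP.i≢suc[i] (trans (sym r≡r') (trans r≡r'+1 (ℤP.+-comm r' 1ℤ))))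
      where
      r≡r' : r ≡ r'
      r≡r' = trans (IsRankBN-unique {A = K (suc k)} {D} rD (IsRankBN-f D))
                   (trans (cong (λ c → + c - 1ℤ) (f≡f[D-e] D v Dv≡0 (ℤP.≰⇒> φ≱0)))
                          (IsRankBN-unique {A = K (suc k)} {D -ᵥ e v} (IsRankBN-f (D -ᵥ e v)) rD'))

theorem6p8 : (m : ℕ) (i : ℤ) (a : ZVec (suc (suc m))) →
    (∀ (j : Fin m) → (0ℤ ≤ a (inject₁ (inject₁ j))) × (a (inject₁ (inject₁ j)) ≤ + suc m)) →
    a (inject₁ (fromℕ m)) ≡ 0ℤ →
    deg a ≡ i →
    ((sumℤ (λ (j : Fin m) → a (inject₁ (inject₁ j))) ≤ i) ⇔ (0ℤ ≤ a (fromℕ (suc m))))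
    × ((0ℤ ≤ a (fromℕ (suc m))) ⇔
       (∃[ r ] ∃[ r' ] (IsRankBN (K (suc (suc m))) a r
                       × IsRankBN (K (suc (suc m))) (a -ᵥ e (inject₁ (fromℕ m))) r'
                       × r ≡ r' + 1ℤ)))
theorem6p8 m i a bounds a[v]≡0 deg≡i =
  subst (λ i → (S ≤ i) ⇔ (0ℤ ≤ L)) (sym i≡S+L) (i≤i+j⇔0≤j S L) ,
  ⇔.trans (⇔.sym (0≤⌊x⌋⇔0≤x L)) (subst (λ z → (0ℤ ≤ z) ⇔ RankDrops a v) (φ-at-0 a Σ⌊init⌋≡0) (φ≥0⇔rank-drops a v a[v]≡0))
  where
  open Floor (suc m)
  open CompleteGraph (suc m)
  v = inject₁ (fromℕ m)
  L = a (fromℕ (suc m))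
  S = sumℤ (λ (j : Fin m) → a (inject₁ (inject₁ j)))
  i≡S+L : i ≡ S + L
  i≡S+L = begin
    i                                ≡⟨ sym deg≡i ⟩
    deg a                            ≡⟨ sumℤ-init-last a ⟩
    sumℤ (λ j → a (inject₁ j)) + L   ≡⟨ cong (_+ L) (sumℤ-init-last (λ j → a (inject₁ j))) ⟩
    S + a v + L                      ≡⟨ cong (λ w → S + w + L) a[v]≡0 ⟩
    S + 0ℤ + L                       ≡⟨ cong (_+ L) (ℤP.+-identityʳ S) ⟩
    S + L                            ∎
    where open ≡-Reasoning
  Σ⌊init⌋≡0 : sumℤ (λ j → ⌊ a (inject₁ j) ⌋) ≡ 0ℤ
  Σ⌊init⌋≡0 = trans (sumℤ-init-last (λ j → ⌊ a (inject₁ j) ⌋))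
                    (cong₂ _+_ (trans (sumℤ-cong small) (sumℤ-zero m)) (cong ⌊_⌋ a[v]≡0))
    where
    small : ∀ j → ⌊ a (inject₁ (inject₁ j)) ⌋ ≡ 0ℤ
    small j = ⌊x⌋≡0 (proj₁ (bounds j)) (ℤP.≤-<-trans (proj₂ (bounds j)) (+<+ ℕP.≤-refl))
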